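{- Let $k,\ell,\alpha,\beta,\gamma$ be non-negative integers with $\alpha\mid\gamma$ and $\alpha\mid\beta$. Then, as formal power series in $x$, $$\sum_{n=0}^{\infty}S^{\gamma,\alpha,\beta}_{n,k,\ell}\frac{x^n}{n!}=\frac{e^{\gamma x}}{k!}\left(e^x+\sum_{i=1}^{\ell}\frac{(\beta)_{i,\alpha}}{\beta}\frac{x^i}{i!}-\sum_{i=0}^{\ell}\frac{x^i}{i!}\right)^k,$$ where $\frac{(\beta)_{i,\alpha}}{\beta}$ denotes $(\beta-\alpha)_{i-1,\alpha}$ (which equals the quotient when $\beta\neq0$).
   Context: Degenerate falling factorial: $(t)_{m,\lambda}=t(t-\lambda)\cdots(t-(m-1)\lambda)$, $(t)_{0,\lambda}=1$. For integers $m,k\ge0$, $S^{\gamma,\alpha,\beta}_{m,k,\ell}$ is the sum over all pairs $(G,P)$, where $G\subseteq\{1,\dots,m\}$ is possibly empty and $P$ is a set partition of $\{1,\dots,m\}\setminus G$ into exactly $k$ non-empty blocks, of the weight $\gamma^{|G|}\prod_{B\in P}w(B)$ with $w(B)=(\beta-\alpha)_{|B|-1,\alpha}$ if $|B|\le\ell$ and $w(B)=1$ if $|B|>\ell$ (and $0^0=1$). (Combinatorially: $G$ is a free cell with $\gamma$ compartments, blocks of size $>\ell$ are free cells of order $1$, blocks of size $\le\ell$ are cells of order $\beta$ with the $\alpha$-closing property and a favorite compartment.) -}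

module Defs where

open import Data.Nat as ℕ using (ℕ; zero; suc; _!; _≤ᵇ_)
open import Data.Nat.Properties using (_!≢0)
open import Data.Integer as ℤ using (ℤ; +_)
open import Data.Rational as ℚ using (ℚ; 0ℚ)
open import Data.List using (List; []; _∷_; [_]; map; concatMap; length; foldr; applyUpTo)
open import Data.Product using (_×_; _,_)
open import Data.Bool using (Bool; true; false; if_then_else_; _∧_)

dff : ℤ → ℤ → ℕ → ℤ
dff t λ′ zero    = + 1
dff t λ′ (suc m) = dff t λ′ m ℤ.* (t ℤ.- (+ m) ℤ.* λ′)

splits : List ℕ → List (List ℕ × List ℕ)
splits []       = ([] , []) ∷ []
splits (x ∷ xs) = concatMap (λ { (g , r) → (x ∷ g , r) ∷ (g , x ∷ r) ∷ [] }) (splits xs)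

insertEach : ℕ → List (List ℕ) → List (List (List ℕ))
insertEach x []       = []
insertEach x (b ∷ bs) = ((x ∷ b) ∷ bs) ∷ map (b ∷_) (insertEach x bs)

-- All set partitions of (the elements of) a duplicate-free list, each listed
-- exactly once (as a list of non-empty blocks): the last-inserted element
-- either forms a new singleton block or joins an existing block.
setPartitions : List ℕ → List (List (List ℕ))
setPartitions []       = [] ∷ []
setPartitions (x ∷ xs) =
  concatMap (λ p → ([ x ] ∷ p) ∷ insertEach x p) (setPartitions xs)

sumℤ : List ℤ → ℤ
sumℤ = foldr ℤ._+_ (+ 0)

prodℤ : List ℤ → ℤ
prodℤ = foldr ℤ._*_ (+ 1)

blockWeight : (ℓ α β : ℕ) → List ℕ → ℤ
blockWeight ℓ α β B =
  if length B ≤ᵇ ℓ then dff (+ β ℤ.- + α) (+ α) (ℕ.pred (length B)) else + 1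

partWeight : (k ℓ α β : ℕ) → List (List ℕ) → ℤ
partWeight k ℓ α β P =
  if length P ℕ.≡ᵇ k then prodℤ (map (blockWeight ℓ α β) P) else + 0

-- S^{γ,α,β}_{m,k,ℓ} : sum over G ⊆ {1..m} and set partitions P of {1..m}∖G
-- into exactly k blocks of γ^{|G|} ∏_{B∈P} w(B).   (ℤ._^_ has 0^0 = 1.)
S : (γ α β m k ℓ : ℕ) → ℤ
S γ α β m k ℓ =
  sumℤ (concatMap
    (λ { (G , R) → map (λ P → (+ γ) ℤ.^ length G ℤ.* partWeight k ℓ α β P)
                       (setPartitions R) })
    (splits (applyUpTo suc m)))

-- Formal power series over ℚ, represented by their (ordinary) coefficient
-- sequences:  f ↦ Σ_n f n · x^n.

Series : Set
Series = ℕ → ℚ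

Σ≤ : ℕ → (ℕ → ℚ) → ℚ
Σ≤ zero    f = f 0
Σ≤ (suc n) f = Σ≤ n f ℚ.+ f (suc n)

_⊕_ : Series → Series → Series
(f ⊕ g) n = f n ℚ.+ g n

_⊖_ : Series → Series → Series
(f ⊖ g) n = f n ℚ.- g n

_⊛_ : Series → Series → Series
(f ⊛ g) n = Σ≤ n (λ i → f i ℚ.* g (n ℕ.∸ i))

oneS : Series
oneS zero    = ℚ.1ℚ
oneS (suc _) = 0ℚ

_^S_ : Series → ℕ → Series
f ^S zero  = oneS
f ^S suc k = f ⊛ (f ^S k)

_·S_ : ℚ → Series → Series
(c ·S f) n = c ℚ.* f n

invFact : ℕ → ℚ
invFact n = (+ 1 ℚ./ n !) {{n !≢0}}

expS : ℤ → Series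
expS c n = (c ℤ.^ n ℚ./ n !) {{n !≢0}}

egf : (ℕ → ℤ) → Series
egf a n = (a n ℚ./ n !) {{n !≢0}}

polyβ : (ℓ α β : ℕ) → Series
polyβ ℓ α β zero = 0ℚ
polyβ ℓ α β (suc i) =
  if suc i ≤ᵇ ℓ then (dff (+ β ℤ.- + α) (+ α) i ℚ./ (suc i) !) {{(suc i) !≢0}} else 0ℚ

truncExp : ℕ → Series
truncExp ℓ i = if i ≤ᵇ ℓ then invFact i else 0ℚ

rhsSeries : (γ α β k ℓ : ℕ) → Series
rhsSeries γ α β k ℓ =
  invFact k ·S (expS (+ γ) ⊛ (((expS (+ 1) ⊕ polyβ ℓ α β) ⊖ truncExp ℓ) ^S k))

{-# OPTIONS --safe #-}
module Submission where

-- Sorting the pairs (G , P) by G writes S as a sum, over the splits of {1..n} into G and its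
-- complement R, of γ^|G| times the weighted count of partitions of R into k blocks.  A sum over
-- splits of a(|G|) b(|R|) is n! times the n-th coefficient of the product of the exponential
-- generating functions of a and b, so it remains to show that the egf F_k of the weighted
-- partitions into k blocks is f^k/k!, where f (blockEgf) is the egf of a single block.  Removing
-- the block that contains the first element gives F_{k+1}' = f' F_k, with F_0 = 1 and
-- F_{k+1}(0) = 0, and f^k/k! satisfies the same recursion.

open import Algebra.Bundles using (CommutativeSemiring; CommutativeRing)
import Algebra.Properties.CommutativeSemigroup as CommSemigroupProperties
open import Data.Bool using (true; false; if_then_else_)
open import Data.Integer as ℤ using (ℤ; +_)
import Data.Integer.Properties as ℤP
open import Data.List using (List; []; _∷_; [_]; _++_; map; concatMap; foldr; length; applyUpTo)
open import Data.List.Properties using (length-applyUpTo)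
open import Data.Nat as ℕ using (ℕ; zero; suc; _!; _≤_; z≤n; _∸_)
open import Data.Nat.Divisibility using (_∣_)
open import Data.Nat.Properties as ℕP using (_!≢0; ≤-refl; m≤n⇒m≤1+n; m+[n∸m]≡n)
open import Data.Product using (_×_; _,_; uncurry; map₂)
open import Data.Rational as ℚ using (ℚ; 0ℚ; 1ℚ)
import Data.Rational.Properties as ℚP
open import Data.Rational.Unnormalised using (mkℚᵘ; *≡*)
import Data.Rational.Unnormalised.Properties as ℚᵘP
open import Function using (id; _∘_)
open import Relation.Binary.PropositionalEquality hiding ([_])
open ≡-Reasoning

open import Defs

module ListSum {c ℓ} (R : CommutativeSemiring c ℓ) where
  open CommutativeSemiring R renaming (refl to ≈-refl; sym to ≈-sym; trans to ≈-trans)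
  open CommSemigroupProperties +-commutativeSemigroup using (interchange)

  ∑ : {A : Set} → List A → (A → Carrier) → Carrier
  ∑ xs f = foldr (λ x s → f x + s) 0# xs

  ∑-cong : {A : Set} (xs : List A) {f g : A → Carrier} → (∀ x → f x ≈ g x) → ∑ xs f ≈ ∑ xs g
  ∑-cong []       f≈g = ≈-refl
  ∑-cong (x ∷ xs) f≈g = +-cong (f≈g x) (∑-cong xs f≈g)

  ∑-++ : {A : Set} (xs ys : List A) (f : A → Carrier) → ∑ (xs ++ ys) f ≈ ∑ xs f + ∑ ys f
  ∑-++ []       ys f = ≈-sym (+-identityˡ _)
  ∑-++ (x ∷ xs) ys f = ≈-trans (+-congˡ (∑-++ xs ys f)) (≈-sym (+-assoc _ _ _))

  ∑-+ : {A : Set} (xs : List A) (f g : A → Carrier) → ∑ xs (λ x → f x + g x) ≈ ∑ xs f + ∑ xs g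
  ∑-+ []       f g = ≈-sym (+-identityˡ 0#)
  ∑-+ (x ∷ xs) f g = ≈-trans (+-congˡ (∑-+ xs f g)) (interchange _ _ _ _)

  ∑-* : {A : Set} (c : Carrier) (xs : List A) (f : A → Carrier) → ∑ xs (λ x → c * f x) ≈ c * ∑ xs f
  ∑-* c []       f = ≈-sym (zeroʳ c)
  ∑-* c (x ∷ xs) f = ≈-trans (+-congˡ (∑-* c xs f)) (≈-sym (distribˡ c _ _))

  ∑-zero : {A : Set} (xs : List A) → ∑ xs (λ _ → 0#) ≈ 0#
  ∑-zero []       = ≈-refl
  ∑-zero (x ∷ xs) = ≈-trans (+-identityˡ _) (∑-zero xs)

  ∑-map : {A B : Set} (h : A → B) (xs : List A) (f : B → Carrier) → ∑ (map h xs) f ≈ ∑ xs (f ∘ h)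
  ∑-map h []       f = ≈-refl
  ∑-map h (x ∷ xs) f = +-congˡ (∑-map h xs f)

  ∑-concatMap : {A B : Set} (g : A → List B) (xs : List A) (f : B → Carrier) →
                ∑ (concatMap g xs) f ≈ ∑ xs (λ x → ∑ (g x) f)
  ∑-concatMap g []       f = ≈-refl
  ∑-concatMap g (x ∷ xs) f = ≈-trans (∑-++ (g x) _ f) (+-congˡ (∑-concatMap g xs f))

  ∑-splits-∷ : ∀ x xs (f : List ℕ × List ℕ → Carrier) →
               ∑ (splits (x ∷ xs)) f ≈ ∑ (splits xs) (λ (g , r) → f (x ∷ g , r) + f (g , x ∷ r))
  ∑-splits-∷ x xs f =
    ≈-trans (∑-concatMap _ (splits xs) f) (∑-cong (splits xs) (λ _ → +-congˡ (+-identityʳ _)))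

  ∑-setPartitions-∷ : ∀ x xs (f : List (List ℕ) → Carrier) →
                      ∑ (setPartitions (x ∷ xs)) f ≈
                      ∑ (setPartitions xs) (λ p → f ([ x ] ∷ p) + ∑ (insertEach x p) f)
  ∑-setPartitions-∷ x xs f = ∑-concatMap _ (setPartitions xs) f

open ListSum ℤP.+-*-commutativeSemiring
module ℚ∑ = ListSum (CommutativeRing.commutativeSemiring ℚP.+-*-commutativeRing)

Block = List ℕ
Partition = List Block

blockChoices : Partition → List (Block × Partition)
blockChoices []       = []
blockChoices (b ∷ bs) = (b , bs) ∷ map (map₂ (b ∷_)) (blockChoices bs)

module _ where
  open import Data.Integer using (_+_)
  open import Data.Integer.Solver using (module +-*-Solver)
  open +-*-Solver using (solve; _:+_; _:=_)

  ∑-insertEach-blockChoices : ∀ y p (G : Block → Partition → ℤ) →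
    ∑ (insertEach y p) (λ q → ∑ (blockChoices q) (uncurry G)) ≡
    ∑ (blockChoices p) (λ (b , r) → G (y ∷ b) r) + ∑ (blockChoices p) (λ (b , r) → ∑ (insertEach y r) (G b))
  ∑-insertEach-blockChoices y []       G = refl
  ∑-insertEach-blockChoices y (b ∷ bs) G = begin
    ∑ (blockChoices ((y ∷ b) ∷ bs)) (uncurry G) + ∑ (map (b ∷_) (insertEach y bs)) marked
      ≡⟨ cong₂ _+_ (cong (_+_ P) (∑-map (map₂ ((y ∷ b) ∷_)) (blockChoices bs) (uncurry G)))
                   (∑-map (b ∷_) (insertEach y bs) marked) ⟩
    (P + Q) + ∑ (insertEach y bs) (λ q → G b q + ∑ (map (map₂ (b ∷_)) (blockChoices q)) (uncurry G))
      ≡⟨ cong (_+_ (P + Q)) (trans (∑-cong (insertEach y bs) (λ q → cong (_+_ (G b q))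
                                      (∑-map (map₂ (b ∷_)) (blockChoices q) (uncurry G))))
                                   (∑-+ (insertEach y bs) (G b) (λ q → ∑ (blockChoices q) (uncurry G′)))) ⟩
    (P + Q) + (X + ∑ (insertEach y bs) (λ q → ∑ (blockChoices q) (uncurry G′)))
      ≡⟨ cong (λ s → (P + Q) + (X + s)) (∑-insertEach-blockChoices y bs G′) ⟩
    (P + Q) + (X + (Y + Z))
      ≡⟨ solve 5 (λ P Q X Y Z → (P :+ Q) :+ (X :+ (Y :+ Z)) := (P :+ Y) :+ (X :+ (Q :+ Z))) refl P Q X Y Z ⟩
    (P + Y) + (X + (Q + Z))
      ≡⟨ cong₂ (λ u v → (P + u) + (X + v)) (∑-map (map₂ (b ∷_)) (blockChoices bs) (λ (c , r) → G (y ∷ c) r))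
               Q+Z ⟨
    ∑ (blockChoices (b ∷ bs)) (λ (c , r) → G (y ∷ c) r) +
    ∑ (blockChoices (b ∷ bs)) (λ (c , r) → ∑ (insertEach y r) (G c)) ∎
    where
    marked : Partition → ℤ
    marked q = ∑ (blockChoices q) (uncurry G)
    G′ : Block → Partition → ℤ
    G′ c r = G c (b ∷ r)
    P = G (y ∷ b) bs
    Q = ∑ (blockChoices bs) (λ (c , r) → G c ((y ∷ b) ∷ r))
    X = ∑ (insertEach y bs) (G b)
    Y = ∑ (blockChoices bs) (λ (c , r) → G′ (y ∷ c) r)
    Z = ∑ (blockChoices bs) (λ (c , r) → ∑ (insertEach y r) (G′ c))
    Q+Z : ∑ (map (map₂ (b ∷_)) (blockChoices bs)) (λ (c , r) → ∑ (insertEach y r) (G c)) ≡ Q + Z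
    Q+Z = begin
      ∑ (map (map₂ (b ∷_)) (blockChoices bs)) (λ (c , r) → ∑ (insertEach y r) (G c))
        ≡⟨ ∑-map (map₂ (b ∷_)) (blockChoices bs) (λ (c , r) → ∑ (insertEach y r) (G c)) ⟩
      ∑ (blockChoices bs) (λ (c , r) → G c ((y ∷ b) ∷ r) + ∑ (map (b ∷_) (insertEach y r)) (G c))
        ≡⟨ ∑-cong (blockChoices bs) (λ (c , r) →
             cong (_+_ (G c ((y ∷ b) ∷ r))) (∑-map (b ∷_) (insertEach y r) (G c))) ⟩
      ∑ (blockChoices bs) (λ (c , r) → G c ((y ∷ b) ∷ r) + ∑ (insertEach y r) (G′ c))
        ≡⟨ ∑-+ (blockChoices bs) (λ (c , r) → G c ((y ∷ b) ∷ r)) (λ (c , r) → ∑ (insertEach y r) (G′ c)) ⟩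
      Q + Z ∎

  -- A partition of xs with one marked block t (t = [] when no block is marked) is the same as a
  -- subset t of xs together with a partition of its complement.
  ∑-markedPartitions : ∀ xs (G : Block → Partition → ℤ) →
    ∑ (setPartitions xs) (λ p → G [] p + ∑ (blockChoices p) (uncurry G)) ≡
    ∑ (splits xs) (λ (t , r) → ∑ (setPartitions r) (G t))
  ∑-markedPartitions []       G = refl
  ∑-markedPartitions (y ∷ ys) G = begin
    ∑ (setPartitions (y ∷ ys)) (markedBy G)
      ≡⟨ ∑-setPartitions-∷ y ys (markedBy G) ⟩
    ∑ (setPartitions ys) (λ p → markedBy G ([ y ] ∷ p) + ∑ (insertEach y p) (markedBy G))
      ≡⟨ ∑-cong (setPartitions ys) split-on-y ⟩
    ∑ (setPartitions ys) (λ p → markedBy G₁ p + markedBy G₂ p)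
      ≡⟨ ∑-+ (setPartitions ys) (markedBy G₁) (markedBy G₂) ⟩
    ∑ (setPartitions ys) (markedBy G₁) + ∑ (setPartitions ys) (markedBy G₂)
      ≡⟨ cong₂ _+_ (∑-markedPartitions ys G₁) (∑-markedPartitions ys G₂) ⟩
    ∑ (splits ys) (λ (t , r) → ∑ (setPartitions r) (G₁ t)) +
    ∑ (splits ys) (λ (t , r) → ∑ (setPartitions r) (G₂ t))
      ≡⟨ ∑-+ (splits ys) (λ (t , r) → ∑ (setPartitions r) (G₁ t)) (λ (t , r) → ∑ (setPartitions r) (G₂ t)) ⟨
    ∑ (splits ys) (λ (t , r) → ∑ (setPartitions r) (G (y ∷ t)) + ∑ (setPartitions r) (G₂ t))
      ≡⟨ ∑-cong (splits ys) (λ (t , r) → cong (_+_ (∑ (setPartitions r) (G (y ∷ t))))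
                                              (∑-setPartitions-∷ y r (G t))) ⟨
    ∑ (splits ys) (λ (t , r) → ∑ (setPartitions r) (G (y ∷ t)) + ∑ (setPartitions (y ∷ r)) (G t))
      ≡⟨ ∑-splits-∷ y ys (λ (t , r) → ∑ (setPartitions r) (G t)) ⟨
    ∑ (splits (y ∷ ys)) (λ (t , r) → ∑ (setPartitions r) (G t)) ∎
    where
    markedBy : (Block → Partition → ℤ) → Partition → ℤ
    markedBy H p = H [] p + ∑ (blockChoices p) (uncurry H)
    -- y lies in the marked block (G₁) or not (G₂).
    G₁ G₂ : Block → Partition → ℤ
    G₁ t q = G (y ∷ t) q
    G₂ t q = G t ([ y ] ∷ q) + ∑ (insertEach y q) (G t)
    split-on-y : ∀ p → markedBy G ([ y ] ∷ p) + ∑ (insertEach y p) (markedBy G) ≡ markedBy G₁ p + markedBy G₂ p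
    split-on-y p = begin
      (a₁ + (a₂ + ∑ (map (map₂ ([ y ] ∷_)) (blockChoices p)) (uncurry G))) + ∑ (insertEach y p) (markedBy G)
        ≡⟨ cong₂ (λ u v → (a₁ + (a₂ + u)) + v) (∑-map (map₂ ([ y ] ∷_)) (blockChoices p) (uncurry G))
                 (trans (∑-+ (insertEach y p) (G []) (λ q → ∑ (blockChoices q) (uncurry G)))
                        (cong (_+_ A) (∑-insertEach-blockChoices y p G))) ⟩
      (a₁ + (a₂ + W)) + (A + (B + C))
        ≡⟨ solve 6 (λ a₁ a₂ W A B C → (a₁ :+ (a₂ :+ W)) :+ (A :+ (B :+ C)) :=
                                      (a₂ :+ B) :+ ((a₁ :+ A) :+ (W :+ C))) refl a₁ a₂ W A B C ⟩
      (a₂ + B) + ((a₁ + A) + (W + C))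
        ≡⟨ cong (λ u → (a₂ + B) + ((a₁ + A) + u))
                (∑-+ (blockChoices p) (λ (b , r) → G b ([ y ] ∷ r)) (λ (b , r) → ∑ (insertEach y r) (G b))) ⟨
      markedBy G₁ p + markedBy G₂ p ∎
      where
      a₁ = G [] ([ y ] ∷ p)
      a₂ = G [ y ] p
      W = ∑ (blockChoices p) (λ (b , r) → G b ([ y ] ∷ r))
      A = ∑ (insertEach y p) (G [])
      B = ∑ (blockChoices p) (λ (b , r) → G (y ∷ b) r)
      C = ∑ (blockChoices p) (λ (b , r) → ∑ (insertEach y r) (G b))

module _ (ℓ α β : ℕ) where
  open import Data.Integer using (_+_; _*_)
  open CommSemigroupProperties ℤP.*-commutativeSemigroup using (x∙yz≈y∙xz)

  -- blockWeight ℓ α β B is definitionally sizeWeight (length B).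
  sizeWeight : ℕ → ℤ
  sizeWeight m = if m ℕ.≤ᵇ ℓ then dff (+ β ℤ.- + α) (+ α) (ℕ.pred m) else + 1

  private
    pw : ℕ → Partition → ℤ
    pw k = partWeight k ℓ α β

  partitionSum : ℕ → List ℕ → ℤ
  partitionSum k xs = ∑ (setPartitions xs) (pw k)

  partWeight-∷ : ∀ k b p → pw (suc k) (b ∷ p) ≡ sizeWeight (length b) * pw k p
  partWeight-∷ k b p with length p ℕ.≡ᵇ k
  ... | true  = refl
  ... | false = sym (ℤP.*-zeroʳ (sizeWeight (length b)))

  partWeight-swap : ∀ k a c r → pw k (a ∷ c ∷ r) ≡ pw k (c ∷ a ∷ r)
  partWeight-swap zero          a c r = refl
  partWeight-swap (suc zero)    a c r = begin
    pw 1 (a ∷ c ∷ r)              ≡⟨ partWeight-∷ 0 a (c ∷ r) ⟩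
    sizeWeight (length a) * + 0   ≡⟨ ℤP.*-zeroʳ (sizeWeight (length a)) ⟩
    + 0                           ≡⟨ ℤP.*-zeroʳ (sizeWeight (length c)) ⟨
    sizeWeight (length c) * + 0   ≡⟨ partWeight-∷ 0 c (a ∷ r) ⟨
    pw 1 (c ∷ a ∷ r)              ∎
  partWeight-swap (suc (suc k)) a c r = begin
    pw (suc (suc k)) (a ∷ c ∷ r)
      ≡⟨ trans (partWeight-∷ (suc k) a (c ∷ r)) (cong (wa *_) (partWeight-∷ k c r)) ⟩
    wa * (wc * pw k r)
      ≡⟨ x∙yz≈y∙xz wa wc (pw k r) ⟩
    wc * (wa * pw k r)
      ≡⟨ trans (partWeight-∷ (suc k) c (a ∷ r)) (cong (wc *_) (partWeight-∷ k a r)) ⟨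
    pw (suc (suc k)) (c ∷ a ∷ r) ∎
    where
    wa = sizeWeight (length a)
    wc = sizeWeight (length c)

  ∑-insertEach-partWeight : ∀ k x p →
    ∑ (insertEach x p) (pw k) ≡ ∑ (blockChoices p) (λ (b , r) → pw k ((x ∷ b) ∷ r))
  ∑-insertEach-partWeight k x []       = refl
  ∑-insertEach-partWeight k x (b ∷ bs) = cong (_+_ (pw k ((x ∷ b) ∷ bs))) (begin
    ∑ (map (b ∷_) (insertEach x bs)) (pw k)
      ≡⟨ ∑-map (b ∷_) (insertEach x bs) (pw k) ⟩
    ∑ (insertEach x bs) (λ q → pw k (b ∷ q))
      ≡⟨ move-b-behind k ⟩
    ∑ (blockChoices bs) (λ (c , r) → pw k ((x ∷ c) ∷ b ∷ r))
      ≡⟨ ∑-map (map₂ (b ∷_)) (blockChoices bs) (λ (c , r) → pw k ((x ∷ c) ∷ r)) ⟨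
    ∑ (map (map₂ (b ∷_)) (blockChoices bs)) (λ (c , r) → pw k ((x ∷ c) ∷ r)) ∎)
    where
    move-b-behind : ∀ k → ∑ (insertEach x bs) (λ q → pw k (b ∷ q)) ≡
                          ∑ (blockChoices bs) (λ (c , r) → pw k ((x ∷ c) ∷ b ∷ r))
    move-b-behind zero    = trans (∑-zero (insertEach x bs)) (sym (∑-zero (blockChoices bs)))
    move-b-behind (suc k) = begin
      ∑ (insertEach x bs) (λ q → pw (suc k) (b ∷ q))
        ≡⟨ ∑-cong (insertEach x bs) (partWeight-∷ k b) ⟩
      ∑ (insertEach x bs) (λ q → wb * pw k q)
        ≡⟨ ∑-* wb (insertEach x bs) (pw k) ⟩
      wb * ∑ (insertEach x bs) (pw k)
        ≡⟨ cong (wb *_) (∑-insertEach-partWeight k x bs) ⟩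
      wb * ∑ (blockChoices bs) (λ (c , r) → pw k ((x ∷ c) ∷ r))
        ≡⟨ ∑-* wb (blockChoices bs) (λ (c , r) → pw k ((x ∷ c) ∷ r)) ⟨
      ∑ (blockChoices bs) (λ (c , r) → wb * pw k ((x ∷ c) ∷ r))
        ≡⟨ ∑-cong (blockChoices bs) (λ (c , r) →
             trans (sym (partWeight-∷ k b ((x ∷ c) ∷ r))) (partWeight-swap (suc k) b (x ∷ c) r)) ⟩
      ∑ (blockChoices bs) (λ (c , r) → pw (suc k) ((x ∷ c) ∷ b ∷ r)) ∎
      where wb = sizeWeight (length b)

  partitionSum-∷ : ∀ k x r → partitionSum k (x ∷ r) ≡
    ∑ (splits r) (λ (t , q) → ∑ (setPartitions q) (λ p → pw k ((x ∷ t) ∷ p)))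
  partitionSum-∷ k x r = begin
    ∑ (setPartitions (x ∷ r)) (pw k)
      ≡⟨ ∑-setPartitions-∷ x r (pw k) ⟩
    ∑ (setPartitions r) (λ p → pw k ([ x ] ∷ p) + ∑ (insertEach x p) (pw k))
      ≡⟨ ∑-cong (setPartitions r) (λ p → cong (_+_ (pw k ([ x ] ∷ p))) (∑-insertEach-partWeight k x p)) ⟩
    ∑ (setPartitions r) (λ p → pw k ([ x ] ∷ p) + ∑ (blockChoices p) (λ (b , q) → pw k ((x ∷ b) ∷ q)))
      ≡⟨ ∑-markedPartitions r (λ t p → pw k ((x ∷ t) ∷ p)) ⟩
    ∑ (splits r) (λ (t , q) → ∑ (setPartitions q) (λ p → pw k ((x ∷ t) ∷ p))) ∎

  partitionSum-zero-∷ : ∀ x r → partitionSum 0 (x ∷ r) ≡ + 0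
  partitionSum-zero-∷ x r = begin
    partitionSum 0 (x ∷ r)
      ≡⟨ partitionSum-∷ 0 x r ⟩
    ∑ (splits r) (λ (t , q) → ∑ (setPartitions q) (λ _ → + 0))
      ≡⟨ ∑-cong (splits r) (λ (t , q) → ∑-zero (setPartitions q)) ⟩
    ∑ (splits r) (λ _ → + 0)
      ≡⟨ ∑-zero (splits r) ⟩
    + 0 ∎

  partitionSum-suc-∷ : ∀ k x r → partitionSum (suc k) (x ∷ r) ≡
    ∑ (splits r) (λ (t , q) → sizeWeight (suc (length t)) * partitionSum k q)
  partitionSum-suc-∷ k x r = trans (partitionSum-∷ (suc k) x r) (∑-cong (splits r) (λ (t , q) →
    trans (∑-cong (setPartitions q) (partWeight-∷ k (x ∷ t)))
          (∑-* (sizeWeight (suc (length t))) (setPartitions q) (pw k))))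

  S-as-∑ : ∀ γ m k → S γ α β m k ℓ ≡
    ∑ (splits (applyUpTo suc m)) (λ (g , r) → (+ γ) ℤ.^ length g * partitionSum k r)
  S-as-∑ γ m k = trans (∑-concatMap _ (splits (applyUpTo suc m)) id) (∑-cong (splits (applyUpTo suc m)) (λ (g , r) →
    trans (∑-map (λ p → (+ γ) ℤ.^ length g * pw k p) (setPartitions r) id)
          (∑-* ((+ γ) ℤ.^ length g) (setPartitions r) (pw k))))

open import Data.Rational using (_+_; _*_; _/_)
open CommSemigroupProperties (CommutativeRing.+-commutativeSemigroup ℚP.+-*-commutativeRing)
  using () renaming (interchange to +-interchange; x∙yz≈y∙xz to +-left-comm)
open CommSemigroupProperties (CommutativeRing.*-commutativeSemigroup ℚP.+-*-commutativeRing)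
  using () renaming (x∙yz≈y∙xz to *-left-comm; xy∙z≈xz∙y to *-right-comm)
open import Data.Rational.Solver using (module +-*-Solver)
open +-*-Solver using (solve; _:+_; _:-_; _:*_; _:=_; con)

ι : ℤ → ℚ
ι i = i / 1

/-cross : ∀ x y m n .{{_ : ℕ.NonZero m}} .{{_ : ℕ.NonZero n}} →
          x ℤ.* + n ≡ y ℤ.* + m → x / m ≡ y / n
/-cross x y (suc m) (suc n) eq = ℚP.fromℚᵘ-cong {mkℚᵘ x m} {mkℚᵘ y n} (*≡* eq)

/-*-/ : ∀ i j m n → (i / suc m) * (j / suc n) ≡ (i ℤ.* j) / (suc m ℕ.* suc n)
/-*-/ i j m n = ℚP.toℚᵘ-injective (ℚᵘP.≃-trans (ℚP.toℚᵘ-homo-* (i / suc m) (j / suc n))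
  (ℚᵘP.≃-trans (ℚᵘP.*-cong (ℚP.toℚᵘ-fromℚᵘ (mkℚᵘ i m)) (ℚP.toℚᵘ-fromℚᵘ (mkℚᵘ j n)))
               (ℚᵘP.≃-sym (ℚP.toℚᵘ-fromℚᵘ (mkℚᵘ (i ℤ.* j) (n ℕ.+ m ℕ.* suc n))))))

ι-* : ∀ i j → ι (i ℤ.* j) ≡ ι i * ι j
ι-* i j = sym (/-*-/ i j 0 0)

ι-+ : ∀ i j → ι (i ℤ.+ j) ≡ ι i + ι j
ι-+ i j = ℚP.toℚᵘ-injective (ℚᵘP.≃-trans (ℚP.toℚᵘ-fromℚᵘ (mkℚᵘ (i ℤ.+ j) 0))
  (ℚᵘP.≃-trans (*≡* eq) (ℚᵘP.≃-sym (ℚᵘP.≃-trans (ℚP.toℚᵘ-homo-+ (ι i) (ι j))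
    (ℚᵘP.+-cong (ℚP.toℚᵘ-fromℚᵘ (mkℚᵘ i 0)) (ℚP.toℚᵘ-fromℚᵘ (mkℚᵘ j 0)))))))
  where
  eq : (i ℤ.+ j) ℤ.* + 1 ≡ (i ℤ.* + 1 ℤ.+ j ℤ.* + 1) ℤ.* + 1
  eq = cong (ℤ._* + 1) (sym (cong₂ ℤ._+_ (ℤP.*-identityʳ i) (ℤP.*-identityʳ j)))

ι-∑ : ∀ {A : Set} (xs : List A) (f : A → ℤ) → ι (∑ xs f) ≡ ℚ∑.∑ xs (ι ∘ f)
ι-∑ []       f = refl
ι-∑ (x ∷ xs) f = trans (ι-+ (f x) (∑ xs f)) (cong (_+_ (ι (f x))) (ι-∑ xs f))

/-as-ι-* : ∀ i d .{{_ : ℕ.NonZero d}} → i / d ≡ ι i * (+ 1 / d)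
/-as-ι-* i (suc d) = sym (trans (/-*-/ i (+ 1) 0 d) (/-cross (i ℤ.* + 1) i _ (suc d) eq))
  where
  eq : i ℤ.* + 1 ℤ.* + suc d ≡ i ℤ.* + (1 ℕ.* suc d)
  eq = cong₂ (λ a b → a ℤ.* + b) (ℤP.*-identityʳ i) (sym (ℕP.*-identityˡ (suc d)))

/!-as-invFact : ∀ i n → (i / n !) {{n !≢0}} ≡ ι i * invFact n
/!-as-invFact i n = /-as-ι-* i (n !) {{n !≢0}}

ι!-*-invFact : ∀ n → ι (+ (n !)) * invFact n ≡ 1ℚ
ι!-*-invFact n = begin
  ι (+ (n !)) * invFact n    ≡⟨ /!-as-invFact (+ (n !)) n ⟨
  (+ (n !) / n !) {{n !≢0}}  ≡⟨ /-cross (+ (n !)) (+ 1) (n !) 1 {{n !≢0}} (ℤP.*-comm (+ (n !)) (+ 1)) ⟩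
  1ℚ                         ∎

ι!-*-invFact-cancel : ∀ n x → ι (+ (n !)) * x * invFact n ≡ x
ι!-*-invFact-cancel n x = begin
  ι (+ (n !)) * x * invFact n  ≡⟨ *-right-comm (ι (+ (n !))) x (invFact n) ⟩
  ι (+ (n !)) * invFact n * x  ≡⟨ cong (_* x) (ι!-*-invFact n) ⟩
  1ℚ * x                       ≡⟨ ℚP.*-identityˡ x ⟩
  x                            ∎

invFact-suc : ∀ n → invFact n ≡ ι (+ suc n) * invFact (suc n)
invFact-suc n = begin
  invFact n                          ≡⟨ /-cross (+ 1) (+ suc n) (n !) (suc n !) {{n !≢0}} {{suc n !≢0}} eq ⟩
  (+ suc n / suc n !) {{suc n !≢0}}  ≡⟨ /!-as-invFact (+ suc n) (suc n) ⟩
  ι (+ suc n) * invFact (suc n)      ∎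
  where
  eq : + 1 ℤ.* + (suc n !) ≡ + suc n ℤ.* + (n !)
  eq = trans (ℤP.*-identityˡ _) (ℤP.pos-* (suc n) (n !))

ι!-suc : ∀ n → ι (+ (suc n !)) ≡ ι (+ (n !)) * ι (+ suc n)
ι!-suc n = begin
  ι (+ (suc n !))            ≡⟨ cong ι (ℤP.pos-* (suc n) (n !)) ⟩
  ι (+ suc n ℤ.* + (n !))    ≡⟨ ι-* (+ suc n) (+ (n !)) ⟩
  ι (+ suc n) * ι (+ (n !))  ≡⟨ ℚP.*-comm (ι (+ suc n)) (ι (+ (n !))) ⟩
  ι (+ (n !)) * ι (+ suc n)  ∎

Σ≤-cong : ∀ n {f g : ℕ → ℚ} → (∀ i → i ≤ n → f i ≡ g i) → Σ≤ n f ≡ Σ≤ n g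
Σ≤-cong zero    f≡g = f≡g 0 z≤n
Σ≤-cong (suc n) f≡g = cong₂ _+_ (Σ≤-cong n (λ i i≤n → f≡g i (m≤n⇒m≤1+n i≤n))) (f≡g (suc n) ≤-refl)

Σ≤-+ : ∀ n (f g : ℕ → ℚ) → Σ≤ n (λ i → f i + g i) ≡ Σ≤ n f + Σ≤ n g
Σ≤-+ zero    f g = refl
Σ≤-+ (suc n) f g = trans (cong (_+ (f (suc n) + g (suc n))) (Σ≤-+ n f g))
                         (+-interchange (Σ≤ n f) (Σ≤ n g) (f (suc n)) (g (suc n)))

Σ≤-* : ∀ n c (f : ℕ → ℚ) → Σ≤ n (λ i → c * f i) ≡ c * Σ≤ n f
Σ≤-* zero    c f = refl
Σ≤-* (suc n) c f = trans (cong (_+ c * f (suc n)) (Σ≤-* n c f)) (sym (ℚP.*-distribˡ-+ c _ _))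

Σ≤-zero : ∀ n → Σ≤ n (λ _ → 0ℚ) ≡ 0ℚ
Σ≤-zero zero    = refl
Σ≤-zero (suc n) = cong (_+ 0ℚ) (Σ≤-zero n)

Σ≤-suc : ∀ n (f : ℕ → ℚ) → Σ≤ (suc n) f ≡ f 0 + Σ≤ n (f ∘ suc)
Σ≤-suc zero    f = refl
Σ≤-suc (suc n) f = trans (cong (_+ f (suc (suc n))) (Σ≤-suc n f))
                         (ℚP.+-assoc (f 0) (Σ≤ n (f ∘ suc)) (f (suc (suc n))))

infix 4 _≐_
_≐_ : Series → Series → Set
f ≐ g = ∀ n → f n ≡ g n

0S : Series
0S _ = 0ℚ

⊛-suc : ∀ a b n → (a ⊛ b) (suc n) ≡ a 0 * b (suc n) + ((a ∘ suc) ⊛ b) n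
⊛-suc a b n = Σ≤-suc n (λ i → a i * b (suc n ∸ i))

⊛-congˡ : ∀ {a a′} b → a ≐ a′ → (a ⊛ b) ≐ (a′ ⊛ b)
⊛-congˡ b a≐a′ n = Σ≤-cong n (λ i _ → cong (_* b (n ∸ i)) (a≐a′ i))

⊛-congʳ : ∀ a {b b′} → b ≐ b′ → (a ⊛ b) ≐ (a ⊛ b′)
⊛-congʳ a b≐b′ n = Σ≤-cong n (λ i _ → cong (a i *_) (b≐b′ (n ∸ i)))

⊛-distribʳ-⊕ : ∀ a a′ b → ((a ⊕ a′) ⊛ b) ≐ ((a ⊛ b) ⊕ (a′ ⊛ b))
⊛-distribʳ-⊕ a a′ b n =
  trans (Σ≤-cong n (λ i _ → ℚP.*-distribʳ-+ (b (n ∸ i)) (a i) (a′ i))) (Σ≤-+ n _ _)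

·S-⊛ : ∀ c a b → ((c ·S a) ⊛ b) ≐ (c ·S (a ⊛ b))
·S-⊛ c a b n = trans (Σ≤-cong n (λ i _ → ℚP.*-assoc c (a i) (b (n ∸ i)))) (Σ≤-* n c _)

⊛-·S : ∀ c a b → (a ⊛ (c ·S b)) ≐ (c ·S (a ⊛ b))
⊛-·S c a b n = trans (Σ≤-cong n (λ i _ → *-left-comm (a i) c (b (n ∸ i)))) (Σ≤-* n c _)

⊛-zeroˡ : ∀ b → (0S ⊛ b) ≐ 0S
⊛-zeroˡ b n = trans (Σ≤-cong n (λ i _ → ℚP.*-zeroˡ (b (n ∸ i)))) (Σ≤-zero n)

⊛-comm : ∀ a b → (a ⊛ b) ≐ (b ⊛ a)
⊛-comm a b zero          = ℚP.*-comm (a 0) (b 0)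
⊛-comm a b (suc zero)    =
  trans (ℚP.+-comm (a 0 * b 1) (a 1 * b 0)) (cong₂ _+_ (ℚP.*-comm (a 1) (b 0)) (ℚP.*-comm (a 0) (b 1)))
⊛-comm a b (suc (suc n)) = begin
  (a ⊛ b) n+2                                ≡⟨ ⊛-suc a b (suc n) ⟩
  a 0 * b n+2 + (a′ ⊛ b) (suc n)             ≡⟨ cong (_+_ (a 0 * b n+2)) (⊛-comm a′ b (suc n)) ⟩
  a 0 * b n+2 + (b ⊛ a′) (suc n)             ≡⟨ cong (_+_ (a 0 * b n+2)) (⊛-suc b a′ n) ⟩
  a 0 * b n+2 + (b 0 * a n+2 + (b′ ⊛ a′) n)  ≡⟨ cong (λ x → a 0 * b n+2 + (b 0 * a n+2 + x)) (⊛-comm b′ a′ n) ⟩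
  a 0 * b n+2 + (b 0 * a n+2 + (a′ ⊛ b′) n)  ≡⟨ +-left-comm (a 0 * b n+2) (b 0 * a n+2) ((a′ ⊛ b′) n) ⟩
  b 0 * a n+2 + (a 0 * b n+2 + (a′ ⊛ b′) n)  ≡⟨ cong (_+_ (b 0 * a n+2)) (⊛-suc a b′ n) ⟨
  b 0 * a n+2 + (a ⊛ b′) (suc n)             ≡⟨ cong (_+_ (b 0 * a n+2)) (⊛-comm a b′ (suc n)) ⟩
  b 0 * a n+2 + (b′ ⊛ a) (suc n)             ≡⟨ ⊛-suc b a (suc n) ⟨
  (b ⊛ a) n+2                                ∎
  where
  n+2 = suc (suc n)
  a′ = a ∘ suc
  b′ = b ∘ suc

⊛-zeroʳ : ∀ a → (a ⊛ 0S) ≐ 0S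
⊛-zeroʳ a n = trans (⊛-comm a 0S n) (⊛-zeroˡ a n)

⊛-assoc : ∀ a b c → ((a ⊛ b) ⊛ c) ≐ (a ⊛ (b ⊛ c))
⊛-assoc a b c zero    = ℚP.*-assoc (a 0) (b 0) (c 0)
⊛-assoc a b c (suc n) = begin
  ((a ⊛ b) ⊛ c) (suc n)                             ≡⟨ ⊛-suc (a ⊛ b) c n ⟩
  a 0 * b 0 * c (suc n) + (((a ⊛ b) ∘ suc) ⊛ c) n   ≡⟨ cong (_+_ (a 0 * b 0 * c (suc n))) tail-step ⟩
  a 0 * b 0 * c (suc n) + (a 0 * (b′ ⊛ c) n + a′bc)
    ≡⟨ solve 5 (λ x y z u v → x :* y :* z :+ (x :* u :+ v) := x :* (y :* z :+ u) :+ v) refl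
               (a 0) (b 0) (c (suc n)) ((b′ ⊛ c) n) a′bc ⟩
  a 0 * (b 0 * c (suc n) + (b′ ⊛ c) n) + a′bc       ≡⟨ cong (λ x → a 0 * x + a′bc) (⊛-suc b c n) ⟨
  a 0 * (b ⊛ c) (suc n) + a′bc                      ≡⟨ ⊛-suc a (b ⊛ c) n ⟨
  (a ⊛ (b ⊛ c)) (suc n)                             ∎
  where
  a′ = a ∘ suc
  b′ = b ∘ suc
  a′bc = (a′ ⊛ (b ⊛ c)) n
  tail-step : (((a ⊛ b) ∘ suc) ⊛ c) n ≡ a 0 * (b′ ⊛ c) n + a′bc
  tail-step = begin
    (((a ⊛ b) ∘ suc) ⊛ c) n                  ≡⟨ ⊛-congˡ c (⊛-suc a b) n ⟩
    (((a 0 ·S b′) ⊕ (a′ ⊛ b)) ⊛ c) n         ≡⟨ ⊛-distribʳ-⊕ (a 0 ·S b′) (a′ ⊛ b) c n ⟩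
    ((a 0 ·S b′) ⊛ c) n + ((a′ ⊛ b) ⊛ c) n   ≡⟨ cong₂ _+_ (·S-⊛ (a 0) b′ c n) (⊛-assoc a′ b c n) ⟩
    a 0 * (b′ ⊛ c) n + a′bc                  ∎

⊛-left-comm : ∀ a b c → (a ⊛ (b ⊛ c)) ≐ (b ⊛ (a ⊛ c))
⊛-left-comm a b c n = begin
  (a ⊛ (b ⊛ c)) n  ≡⟨ ⊛-assoc a b c n ⟨
  ((a ⊛ b) ⊛ c) n  ≡⟨ ⊛-congˡ c (⊛-comm a b) n ⟩
  ((b ⊛ a) ⊛ c) n  ≡⟨ ⊛-assoc b a c n ⟩
  (b ⊛ (a ⊛ c)) n  ∎

xD : Series → Series
xD s n = ι (+ n) * s n

D : Series → Series
D s n = ι (+ suc n) * s (suc n)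

xD-⊛ : ∀ a b → xD (a ⊛ b) ≐ ((xD a ⊛ b) ⊕ (a ⊛ xD b))
xD-⊛ a b n = begin
  ι (+ n) * Σ≤ n (λ i → a i * b (n ∸ i))                ≡⟨ Σ≤-* n (ι (+ n)) _ ⟨
  Σ≤ n (λ i → ι (+ n) * (a i * b (n ∸ i)))              ≡⟨ Σ≤-cong n split ⟩
  Σ≤ n (λ i → xD a i * b (n ∸ i) + a i * xD b (n ∸ i))  ≡⟨ Σ≤-+ n _ _ ⟩
  (xD a ⊛ b) n + (a ⊛ xD b) n                           ∎
  where
  split : ∀ i → i ≤ n → ι (+ n) * (a i * b (n ∸ i)) ≡ xD a i * b (n ∸ i) + a i * xD b (n ∸ i)
  split i i≤n = begin
    ι (+ n) * (a i * b (n ∸ i))                ≡⟨ cong (λ m → ι (+ m) * (a i * b (n ∸ i))) (m+[n∸m]≡n i≤n) ⟨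
    ι (+ i ℤ.+ + (n ∸ i)) * (a i * b (n ∸ i))  ≡⟨ cong (_* (a i * b (n ∸ i))) (ι-+ (+ i) (+ (n ∸ i))) ⟩
    (ι (+ i) + ι (+ (n ∸ i))) * (a i * b (n ∸ i))
      ≡⟨ solve 4 (λ p q x y → (p :+ q) :* (x :* y) := p :* x :* y :+ x :* (q :* y)) refl
               (ι (+ i)) (ι (+ (n ∸ i))) (a i) (b (n ∸ i)) ⟩
    xD a i * b (n ∸ i) + a i * xD b (n ∸ i)    ∎

xD-⊛-suc : ∀ a b n → (xD a ⊛ b) (suc n) ≡ (D a ⊛ b) n
xD-⊛-suc a b n = begin
  (xD a ⊛ b) (suc n)                  ≡⟨ ⊛-suc (xD a) b n ⟩
  0ℚ * a 0 * b (suc n) + (D a ⊛ b) n  ≡⟨ cong (_+ (D a ⊛ b) n) (trans (cong (_* b (suc n)) (ℚP.*-zeroˡ (a 0)))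
                                                                      (ℚP.*-zeroˡ (b (suc n)))) ⟩
  0ℚ + (D a ⊛ b) n                    ≡⟨ ℚP.+-identityˡ _ ⟩
  (D a ⊛ b) n                         ∎

D-⊛ : ∀ a b → D (a ⊛ b) ≐ ((D a ⊛ b) ⊕ (a ⊛ D b))
D-⊛ a b n = begin
  D (a ⊛ b) n                              ≡⟨ xD-⊛ a b (suc n) ⟩
  (xD a ⊛ b) (suc n) + (a ⊛ xD b) (suc n)  ≡⟨ cong₂ _+_ (xD-⊛-suc a b n) (⊛-comm a (xD b) (suc n)) ⟩
  (D a ⊛ b) n + (xD b ⊛ a) (suc n)         ≡⟨ cong (_+_ ((D a ⊛ b) n)) (trans (xD-⊛-suc b a n) (⊛-comm (D b) a n)) ⟩
  (D a ⊛ b) n + (a ⊛ D b) n                ∎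

D-·S : ∀ c s → D (c ·S s) ≐ (c ·S D s)
D-·S c s n = *-left-comm (ι (+ suc n)) c (s (suc n))

D-oneS : D oneS ≐ 0S
D-oneS n = ℚP.*-zeroʳ (ι (+ suc n))

D-^S : ∀ f k → D (f ^S suc k) ≐ (ι (+ suc k) ·S (D f ⊛ (f ^S k)))
D-^S f zero n = begin
  D (f ⊛ oneS) n                   ≡⟨ D-⊛ f oneS n ⟩
  (D f ⊛ oneS) n + (f ⊛ D oneS) n  ≡⟨ cong (_+_ ((D f ⊛ oneS) n)) (trans (⊛-congʳ f D-oneS n) (⊛-zeroʳ f n)) ⟩
  (D f ⊛ oneS) n + 0ℚ              ≡⟨ ℚP.+-identityʳ _ ⟩
  (D f ⊛ oneS) n                   ≡⟨ ℚP.*-identityˡ _ ⟨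
  1ℚ * (D f ⊛ oneS) n              ∎
D-^S f (suc k) n = begin
  D (f ⊛ fᵏ⁺¹) n                                     ≡⟨ D-⊛ f fᵏ⁺¹ n ⟩
  (D f ⊛ fᵏ⁺¹) n + (f ⊛ D fᵏ⁺¹) n
    ≡⟨ cong (_+_ ((D f ⊛ fᵏ⁺¹) n)) (⊛-congʳ f (D-^S f k) n) ⟩
  (D f ⊛ fᵏ⁺¹) n + (f ⊛ (k+1 ·S (D f ⊛ fᵏ))) n
    ≡⟨ cong (_+_ ((D f ⊛ fᵏ⁺¹) n)) (trans (⊛-·S k+1 f (D f ⊛ fᵏ) n) (cong (k+1 *_) (⊛-left-comm f (D f) fᵏ n))) ⟩
  (D f ⊛ fᵏ⁺¹) n + k+1 * (D f ⊛ fᵏ⁺¹) n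
    ≡⟨ solve 2 (λ x m → x :+ m :* x := (con 1ℚ :+ m) :* x) refl ((D f ⊛ fᵏ⁺¹) n) k+1 ⟩
  (1ℚ + k+1) * (D f ⊛ fᵏ⁺¹) n
    ≡⟨ cong (_* (D f ⊛ fᵏ⁺¹) n) (ι-+ (+ 1) (+ suc k)) ⟨
  ι (+ suc (suc k)) * (D f ⊛ fᵏ⁺¹) n ∎
  where
  k+1 = ι (+ suc k)
  fᵏ = f ^S k
  fᵏ⁺¹ = f ^S suc k

egfℚ : (ℕ → ℚ) → Series
egfℚ a j = a j * invFact j

egfℚ-suc : ∀ a → egfℚ (a ∘ suc) ≐ D (egfℚ a)
egfℚ-suc a j =
  trans (cong (a (suc j) *_) (invFact-suc j)) (*-left-comm (a (suc j)) (ι (+ suc j)) (invFact (suc j)))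

egfℚ-ι!-* : ∀ s → egfℚ (λ j → ι (+ (j !)) * s j) ≐ s
egfℚ-ι!-* s j = ι!-*-invFact-cancel j (s j)

ι!-*-D : ∀ s n → ι (+ (n !)) * D s n ≡ ι (+ (suc n !)) * s (suc n)
ι!-*-D s n = begin
  ι (+ (n !)) * (ι (+ suc n) * s (suc n))  ≡⟨ ℚP.*-assoc (ι (+ (n !))) (ι (+ suc n)) (s (suc n)) ⟨
  ι (+ (n !)) * ι (+ suc n) * s (suc n)    ≡⟨ cong (_* s (suc n)) (ι!-suc n) ⟨
  ι (+ (suc n !)) * s (suc n)              ∎

∑-splits-convolution : ∀ xs (a b : ℕ → ℚ) →
  ℚ∑.∑ (splits xs) (λ (g , r) → a (length g) * b (length r)) ≡
  ι (+ (length xs !)) * (egfℚ a ⊛ egfℚ b) (length xs)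
∑-splits-convolution [] a b =
  solve 2 (λ x y → x :* y :+ con 0ℚ := con 1ℚ :* ((x :* con 1ℚ) :* (y :* con 1ℚ))) refl (a 0) (b 0)
∑-splits-convolution (x ∷ xs) a b = begin
  ℚ∑.∑ (splits (x ∷ xs)) (λ (g , r) → a (length g) * b (length r))
    ≡⟨ ℚ∑.∑-splits-∷ x xs (λ (g , r) → a (length g) * b (length r)) ⟩
  ℚ∑.∑ (splits xs) (λ (g , r) → a′ (length g) * b (length r) + a (length g) * b′ (length r))
    ≡⟨ ℚ∑.∑-+ (splits xs) (λ (g , r) → a′ (length g) * b (length r)) (λ (g , r) → a (length g) * b′ (length r)) ⟩
  ℚ∑.∑ (splits xs) (λ (g , r) → a′ (length g) * b (length r)) +
  ℚ∑.∑ (splits xs) (λ (g , r) → a (length g) * b′ (length r))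
    ≡⟨ cong₂ _+_ (∑-splits-convolution xs a′ b) (∑-splits-convolution xs a b′) ⟩
  n! * (egfℚ a′ ⊛ egfℚ b) n + n! * (egfℚ a ⊛ egfℚ b′) n
    ≡⟨ cong₂ (λ u v → n! * u + n! * v) (⊛-congˡ (egfℚ b) (egfℚ-suc a) n) (⊛-congʳ (egfℚ a) (egfℚ-suc b) n) ⟩
  n! * (D â ⊛ b̂) n + n! * (â ⊛ D b̂) n  ≡⟨ ℚP.*-distribˡ-+ n! _ _ ⟨
  n! * ((D â ⊛ b̂) n + (â ⊛ D b̂) n)     ≡⟨ cong (n! *_) (D-⊛ â b̂ n) ⟨
  n! * D (â ⊛ b̂) n                     ≡⟨ ι!-*-D (â ⊛ b̂) n ⟩
  ι (+ (suc n !)) * (â ⊛ b̂) (suc n)    ∎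
  where
  n = length xs
  n! = ι (+ (n !))
  a′ = a ∘ suc
  b′ = b ∘ suc
  â = egfℚ a
  b̂ = egfℚ b

∑-splits-egf : ∀ (c : ℕ → ℤ) (P : List ℕ → ℤ) (F : Series) →
  (∀ r → ι (P r) ≡ ι (+ (length r !)) * F (length r)) →
  ∀ xs → ι (∑ (splits xs) (λ (g , r) → c (length g) ℤ.* P r)) ≡
         ι (+ (length xs !)) * (egfℚ (ι ∘ c) ⊛ F) (length xs)
∑-splits-egf c P F P≡F xs = begin
  ι (∑ (splits xs) summand)
    ≡⟨ ι-∑ (splits xs) summand ⟩
  ℚ∑.∑ (splits xs) (ι ∘ summand)
    ≡⟨ ℚ∑.∑-cong (splits xs) (λ (g , r) →
         trans (ι-* (c (length g)) (P r)) (cong (ι (c (length g)) *_) (P≡F r))) ⟩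
  ℚ∑.∑ (splits xs) (λ (g , r) → ι (c (length g)) * (ι (+ (length r !)) * F (length r)))
    ≡⟨ ∑-splits-convolution xs (ι ∘ c) (λ j → ι (+ (j !)) * F j) ⟩
  ι (+ (length xs !)) * (egfℚ (ι ∘ c) ⊛ egfℚ (λ j → ι (+ (j !)) * F j)) (length xs)
    ≡⟨ cong (ι (+ (length xs !)) *_) (⊛-congʳ (egfℚ (ι ∘ c)) (egfℚ-ι!-* F) (length xs)) ⟩
  ι (+ (length xs !)) * (egfℚ (ι ∘ c) ⊛ F) (length xs) ∎
  where
  summand : List ℕ × List ℕ → ℤ
  summand (g , r) = c (length g) ℤ.* P r

expS-egfℚ : ∀ c → expS c ≐ egfℚ (λ j → ι (c ℤ.^ j))
expS-egfℚ c j = /!-as-invFact (c ℤ.^ j) j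

expS-1 : ∀ j → expS (+ 1) j ≡ invFact j
expS-1 j = cong (λ i → (i / j !) {{j !≢0}}) (ℤP.^-zeroˡ j)

module _ (ℓ α β : ℕ) where

  blockEgf : Series
  blockEgf = (expS (+ 1) ⊕ polyβ ℓ α β) ⊖ truncExp ℓ

  partitionEgf : ℕ → Series
  partitionEgf k = invFact k ·S (blockEgf ^S k)

  blockEgf-suc : ∀ j → blockEgf (suc j) ≡ egfℚ (ι ∘ sizeWeight ℓ α β) (suc j)
  blockEgf-suc j with suc j ℕ.≤ᵇ ℓ
  ... | true  = begin
    expS (+ 1) (suc j) + (d / suc j !) {{suc j !≢0}} ℚ.- invFact (suc j)
      ≡⟨ cong₂ (λ u v → u + v ℚ.- invFact (suc j)) (expS-1 (suc j)) (/!-as-invFact d (suc j)) ⟩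
    invFact (suc j) + ι d * invFact (suc j) ℚ.- invFact (suc j)
      ≡⟨ solve 2 (λ i x → i :+ x :- i := x) refl (invFact (suc j)) (ι d * invFact (suc j)) ⟩
    ι d * invFact (suc j) ∎
    where d = dff (+ β ℤ.- + α) (+ α) j
  ... | false = trans (cong (λ u → u + 0ℚ ℚ.- 0ℚ) (expS-1 (suc j)))
                      (solve 1 (λ i → i :+ con 0ℚ :- con 0ℚ := con 1ℚ :* i) refl (invFact (suc j)))

  D-blockEgf : D blockEgf ≐ egfℚ (ι ∘ sizeWeight ℓ α β ∘ suc)
  D-blockEgf j = trans (cong (ι (+ suc j) *_) (blockEgf-suc j)) (sym (egfℚ-suc (ι ∘ sizeWeight ℓ α β) j))

  D-partitionEgf : ∀ k → D (partitionEgf (suc k)) ≐ (D blockEgf ⊛ partitionEgf k)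
  D-partitionEgf k n = begin
    D (partitionEgf (suc k)) n                         ≡⟨ D-·S (invFact (suc k)) (blockEgf ^S suc k) n ⟩
    invFact (suc k) * D (blockEgf ^S suc k) n          ≡⟨ cong (invFact (suc k) *_) (D-^S blockEgf k n) ⟩
    invFact (suc k) * (ι (+ suc k) * f′fᵏ)             ≡⟨ *-left-comm (invFact (suc k)) (ι (+ suc k)) f′fᵏ ⟩
    ι (+ suc k) * (invFact (suc k) * f′fᵏ)             ≡⟨ ℚP.*-assoc (ι (+ suc k)) (invFact (suc k)) f′fᵏ ⟨
    ι (+ suc k) * invFact (suc k) * f′fᵏ               ≡⟨ cong (_* f′fᵏ) (invFact-suc k) ⟨
    invFact k * f′fᵏ                                   ≡⟨ ⊛-·S (invFact k) (D blockEgf) (blockEgf ^S k) n ⟨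
    (D blockEgf ⊛ partitionEgf k) n                    ∎
    where f′fᵏ = (D blockEgf ⊛ (blockEgf ^S k)) n

  partitionEgf-suc-zero : ∀ k → partitionEgf (suc k) 0 ≡ 0ℚ
  partitionEgf-suc-zero k =
    trans (cong (invFact (suc k) *_) (ℚP.*-zeroˡ ((blockEgf ^S k) 0))) (ℚP.*-zeroʳ (invFact (suc k)))

  partitionSum-egf : ∀ k xs → ι (partitionSum ℓ α β k xs) ≡ ι (+ (length xs !)) * partitionEgf k (length xs)
  partitionSum-egf zero    []       = refl
  partitionSum-egf (suc k) []       = sym (trans (cong (1ℚ *_) (partitionEgf-suc-zero k)) (ℚP.*-zeroʳ 1ℚ))
  partitionSum-egf zero    (x ∷ xs) =
    trans (cong ι (partitionSum-zero-∷ ℓ α β x xs)) (sym (ℚP.*-zeroʳ (ι (+ (suc (length xs) !)))))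
  partitionSum-egf (suc k) (x ∷ xs) = begin
    ι (partitionSum ℓ α β (suc k) (x ∷ xs))
      ≡⟨ cong ι (partitionSum-suc-∷ ℓ α β k x xs) ⟩
    ι (∑ (splits xs) (λ (t , q) → sizeWeight ℓ α β (suc (length t)) ℤ.* partitionSum ℓ α β k q))
      ≡⟨ ∑-splits-egf (sizeWeight ℓ α β ∘ suc) (partitionSum ℓ α β k) (partitionEgf k) (partitionSum-egf k) xs ⟩
    n! * (egfℚ (ι ∘ sizeWeight ℓ α β ∘ suc) ⊛ partitionEgf k) n
      ≡⟨ cong (n! *_) (⊛-congˡ (partitionEgf k) (λ j → sym (D-blockEgf j)) n) ⟩
    n! * (D blockEgf ⊛ partitionEgf k) n
      ≡⟨ cong (n! *_) (D-partitionEgf k n) ⟨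
    n! * D (partitionEgf (suc k)) n
      ≡⟨ ι!-*-D (partitionEgf (suc k)) n ⟩
    ι (+ (suc n !)) * partitionEgf (suc k) (suc n) ∎
    where
    n = length xs
    n! = ι (+ (n !))

  S-egf : ∀ γ k n → ι (S γ α β n k ℓ) ≡ ι (+ (n !)) * (expS (+ γ) ⊛ partitionEgf k) n
  S-egf γ k n = begin
    ι (S γ α β n k ℓ)
      ≡⟨ cong ι (S-as-∑ ℓ α β γ n k) ⟩
    ι (∑ (splits xs) (λ (g , r) → (+ γ) ℤ.^ length g ℤ.* partitionSum ℓ α β k r))
      ≡⟨ ∑-splits-egf ((+ γ) ℤ.^_) (partitionSum ℓ α β k) (partitionEgf k) (partitionSum-egf k) xs ⟩
    ι (+ (length xs !)) * (egfℚ (λ j → ι ((+ γ) ℤ.^ j)) ⊛ partitionEgf k) (length xs)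
      ≡⟨ cong (λ m → ι (+ (m !)) * (egfℚ (λ j → ι ((+ γ) ℤ.^ j)) ⊛ partitionEgf k) m) (length-applyUpTo suc n) ⟩
    ι (+ (n !)) * (egfℚ (λ j → ι ((+ γ) ℤ.^ j)) ⊛ partitionEgf k) n
      ≡⟨ cong (ι (+ (n !)) *_) (⊛-congˡ (partitionEgf k) (expS-egfℚ (+ γ)) n) ⟨
    ι (+ (n !)) * (expS (+ γ) ⊛ partitionEgf k) n ∎
    where xs = applyUpTo suc n

mainTheorem7 : (k ℓ α β γ : ℕ) → α ∣ γ → α ∣ β →
    (n : ℕ) → egf (λ m → S γ α β m k ℓ) n ≡ rhsSeries γ α β k ℓ n
mainTheorem7 k ℓ α β γ _ _ n = begin
  egf (λ m → S γ α β m k ℓ) n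
    ≡⟨ /!-as-invFact (S γ α β n k ℓ) n ⟩
  ι (S γ α β n k ℓ) * invFact n
    ≡⟨ cong (_* invFact n) (S-egf ℓ α β γ k n) ⟩
  ι (+ (n !)) * (expS (+ γ) ⊛ partitionEgf ℓ α β k) n * invFact n
    ≡⟨ ι!-*-invFact-cancel n _ ⟩
  (expS (+ γ) ⊛ partitionEgf ℓ α β k) n
    ≡⟨ ⊛-·S (invFact k) (expS (+ γ)) (blockEgf ℓ α β ^S k) n ⟩
  rhsSeries γ α β k ℓ n ∎
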